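{- Let $(W,B)$ be a spherical latin bitrade, let $\mathcal{A}$ and $\mathcal{A}^*$ be as defined in the context. Then $\mathcal{A}\cong\mathcal{A}^*\oplus\mathbb{Z}\oplus\mathbb{Z}$.
   Context: A latin bitrade is a pair $(W,B)$ of non-empty finite sets of triples (row, column, symbol), any two distinct triples in the same set agreeing in at most one coordinate, such that for each $(r,c,s)\in W$ (resp. $B$) there exist unique $r'\ne r$, $c'\ne c$, $s'\ne s$ with $(r',c,s),(r,c',s),(r,c,s')\in B$ (resp. $W$). It is connected if it is not the union of two latin bitrades $(W',B')$, $(W'',B'')$ with $W'\cap W''=\emptyset$. With $R,C,S$ the pairwise disjoint sets of rows, columns, symbols used: for each row $r$ let $\psi_r(s)=s'$ iff $(r,c,s)\in W$, $(r,c,s')\in B$ for some $c$, and define analogous permutations for columns and symbols; the bitrade is separated if all are single cycles. It is spherical if it is separated, connected and $2+|W|-|R|-|C|-|S|=0$ (genus $0$). Let $\mathcal{V}=R\cup C\cup S$, regarded as commuting indeterminates. Define the abelian group $\mathcal{A}=\langle \mathcal{V}\mid r+c+s=0 \text{ for all }(r,c,s)\in W\rangle$. Fix a triple $(r_0,c_0,s_0)\in W$ and define $\mathcal{A}^*=\langle \mathcal{V}\mid r+c+s=0 \text{ for all }(r,c,s)\in W;\ r_0=c_0=s_0=0\rangle$. -}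

module Defs where

open import Level using (0ℓ)
open import Data.Nat using (ℕ)
open import Data.Fin using (Fin)
open import Data.Fin.Properties using () renaming (_≟_ to _≟F_)
open import Data.Integer using (ℤ; _+_; _*_; -_; 0ℤ; 1ℤ)
open import Data.Integer.Properties
open import Data.Integer.Properties using (+-0-abelianGroup)
open import Data.Product using (Σ; ∃; _×_; _,_; proj₁; proj₂)
open import Data.Sum using (_⊎_; inj₁; inj₂)
open import Data.Sum.Properties using (≡-dec)
open import Data.List using (List; []; _∷_; _++_; map)
open import Data.List.Membership.Propositional using (_∈_)
open import Data.List.Membership.Propositional.Properties using (∈-map⁺)
open import Data.List.Relation.Unary.All using (All; []; _∷_)
open import Data.List.Relation.Unary.All.Properties using (++⁺)
open import Relation.Binary.PropositionalEquality
open import Relation.Binary.Construct.Closure.ReflexiveTransitive using (Star)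
open import Relation.Nullary using (¬_; yes; no)
open import Function using (_⇔_)
open import Algebra.Bundles using (AbelianGroup)
open import Algebra.Structures using (IsAbelianGroup)
import Algebra.Construct.DirectProduct as DP

-- Triples.  Rows, columns and symbols are Fin nR, Fin nC, Fin nS; these
-- three sets are kept disjoint by working with the tagged sum below.

Triple : ℕ → ℕ → ℕ → Set
Triple nR nC nS = Fin nR × Fin nC × Fin nS

module _ {nR nC nS : ℕ} where

  T = Triple nR nC nS

  PartialLatin : List T → Set
  PartialLatin X = ∀ {r c s r' c' s'} →
    (r , c , s) ∈ X → (r' , c' , s') ∈ X → (r , c , s) ≢ (r' , c' , s') →
    ¬ (r ≡ r' × c ≡ c') × ¬ (r ≡ r' × s ≡ s') × ¬ (c ≡ c' × s ≡ s')

  ∃!′ : {A : Set} → (A → Set) → Set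
  ∃!′ {A} P = Σ A λ x → P x × (∀ y → P y → x ≡ y)

  Mates : List T → List T → Set
  Mates X Y = ∀ {r c s} → (r , c , s) ∈ X →
      ∃!′ (λ r' → r' ≢ r × (r' , c , s) ∈ Y)
    × ∃!′ (λ c' → c' ≢ c × (r , c' , s) ∈ Y)
    × ∃!′ (λ s' → s' ≢ s × (r , c , s') ∈ Y)

  NonEmpty : List T → Set
  NonEmpty X = ∃ λ t → t ∈ X

  -- latin bitrade (finite sets of triples given as lists; only membership matters)
  record IsBitrade (W B : List T) : Set where
    field
      W-nonempty : NonEmpty W
      B-nonempty : NonEmpty B
      W-latin    : PartialLatin W
      B-latin    : PartialLatin B
      W→B        : Mates W B
      B→W        : Mates B W

  Connected : List T → List T → Set
  Connected W B = ¬ (Σ (List T) λ W' → Σ (List T) λ B' → Σ (List T) λ W'' → Σ (List T) λ B'' →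
      IsBitrade W' B' × IsBitrade W'' B''
    × (∀ t → (t ∈ W) ⇔ (t ∈ W' ⊎ t ∈ W''))
    × (∀ t → (t ∈ B) ⇔ (t ∈ B' ⊎ t ∈ B''))
    × (∀ t → t ∈ W' → t ∈ W'' → ⊥′))
    where open import Data.Empty renaming (⊥ to ⊥′)

  ψRow : List T → List T → Fin nR → Fin nS → Fin nS → Set
  ψRow W B r s s' = ∃ λ c → (r , c , s) ∈ W × (r , c , s') ∈ B
  ψCol : List T → List T → Fin nC → Fin nR → Fin nR → Set
  ψCol W B c r r' = ∃ λ s → (r , c , s) ∈ W × (r' , c , s) ∈ B
  ψSym : List T → List T → Fin nS → Fin nC → Fin nC → Set
  ψSym W B s c c' = ∃ λ r → (r , c , s) ∈ W × (r , c' , s) ∈ B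

  -- a permutation ψ of its (finite) domain D is a single cycle iff every
  -- point of D is reached from every other by iterating ψ
  SingleCycle : {A : Set} → (A → Set) → (A → A → Set) → Set
  SingleCycle D ψ = ∀ x y → D x → D y → Star ψ x y

  Separated : List T → List T → Set
  Separated W B =
      (∀ r → SingleCycle (λ s → ∃ λ c → (r , c , s) ∈ W) (ψRow W B r))
    × (∀ c → SingleCycle (λ r → ∃ λ s → (r , c , s) ∈ W) (ψCol W B c))
    × (∀ s → SingleCycle (λ c → ∃ λ r → (r , c , s) ∈ W) (ψSym W B s))

  AllUsed : List T → Set
  AllUsed W = (∀ r → ∃ λ c → ∃ λ s → (r , c , s) ∈ W)
            × (∀ c → ∃ λ r → ∃ λ s → (r , c , s) ∈ W)
            × (∀ s → ∃ λ r → ∃ λ c → (r , c , s) ∈ W)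

  open import Data.List.Relation.Unary.Unique.Propositional using (Unique)

  record IsSphericalBitrade (W B : List T) : Set where
    field
      bitrade   : IsBitrade W B
      W-unique  : Unique W
      B-unique  : Unique B
      allUsed   : AllUsed W
      connected : Connected W B
      separated : Separated W B
      -- genus 0 : 2 + |W| - |R| - |C| - |S| = 0
      genus0    : 2 Data.Nat.+ Data.List.length W ≡ nR Data.Nat.+ nC Data.Nat.+ nS

-- Finitely presented abelian groups  ⟨ V ∣ rels ⟩  (V finite).
-- Elements: ℤ^V = functions V → ℤ (the free abelian group on V, V finite).
-- f ≈ g  iff  f - g is an integer combination of relators.

combo : {V : Set} → List (ℤ × (V → ℤ)) → V → ℤ
combo []             v = 0ℤ
combo ((k , ρ) ∷ ks) v = k * ρ v + combo ks v

module Presented {V : Set} (rels : List (V → ℤ)) where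

  Elt : Set
  Elt = V → ℤ

  record _≈_ (f g : Elt) : Set where
    constructor mk≈
    field
      coeffs : List (ℤ × (V → ℤ))
      fromRels : All (λ p → proj₂ p ∈ rels) coeffs
      eqn : ∀ v → f v ≡ g v + combo coeffs v

  _∙_ : Elt → Elt → Elt
  (f ∙ g) v = f v + g v

  ε : Elt
  ε _ = 0ℤ

  _⁻¹ : Elt → Elt
  (f ⁻¹) v = - f v

  neg : List (ℤ × (V → ℤ)) → List (ℤ × (V → ℤ))
  neg = map (λ p → (- proj₁ p , proj₂ p))

  neg-all : ∀ ks → All (λ p → proj₂ p ∈ rels) ks → All (λ p → proj₂ p ∈ rels) (neg ks)
  neg-all [] [] = []
  neg-all (_ ∷ ks) (m ∷ ms) = m ∷ neg-all ks ms

  combo-neg : ∀ ks v → combo (neg ks) v ≡ - combo {V} ks v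
  combo-neg [] v = refl
  combo-neg ((k , ρ) ∷ ks) v = begin
      - k * ρ v + combo (neg ks) v  ≡⟨ cong₂ _+_ (sym (neg-distribˡ-* k (ρ v))) (combo-neg ks v) ⟩
      - (k * ρ v) + - combo {V} ks v    ≡⟨ sym (neg-distrib-+ (k * ρ v) (combo {V} ks v)) ⟩
      - (k * ρ v + combo {V} ks v)      ∎
    where open ≡-Reasoning

  combo-++ : ∀ ks ls v → combo (ks ++ ls) v ≡ combo {V} ks v + combo {V} ls v
  combo-++ [] ls v = sym (+-identityˡ _)
  combo-++ ((k , ρ) ∷ ks) ls v =
    trans (cong (k * ρ v +_) (combo-++ ks ls v)) (sym (+-assoc (k * ρ v) _ _))

  pw : ∀ {f g} → (∀ v → f v ≡ g v) → f ≈ g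
  pw {f} {g} e = mk≈ [] [] λ v → trans (e v) (sym (+-identityʳ (g v)))

  ≈-refl : ∀ {f} → f ≈ f
  ≈-refl = pw (λ _ → refl)

  ≈-sym : ∀ {f g} → f ≈ g → g ≈ f
  ≈-sym {f} {g} (mk≈ ks ms e) = mk≈ (neg ks) (neg-all ks ms) λ v → begin
      g v                               ≡⟨ sym (+-identityʳ (g v)) ⟩
      g v + 0ℤ                          ≡⟨ cong (g v +_) (sym (+-inverseʳ (combo {V} ks v))) ⟩
      g v + (combo {V} ks v + - combo {V} ks v) ≡⟨ sym (+-assoc (g v) _ _) ⟩
      (g v + combo {V} ks v) + - combo {V} ks v ≡⟨ cong₂ _+_ (sym (e v)) (sym (combo-neg ks v)) ⟩
      f v + combo (neg ks) v            ∎
    where open ≡-Reasoning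

  ≈-trans : ∀ {f g h} → f ≈ g → g ≈ h → f ≈ h
  ≈-trans {f} {g} {h} (mk≈ ks ms e) (mk≈ ls ns e') = mk≈ (ls ++ ks) (++⁺ ns ms) λ v → begin
      f v                           ≡⟨ e v ⟩
      g v + combo {V} ks v              ≡⟨ cong (_+ combo {V} ks v) (e' v) ⟩
      (h v + combo {V} ls v) + combo {V} ks v ≡⟨ +-assoc (h v) _ _ ⟩
      h v + (combo {V} ls v + combo {V} ks v) ≡⟨ cong (h v +_) (sym (combo-++ ls ks v)) ⟩
      h v + combo (ls ++ ks) v      ∎
    where open ≡-Reasoning

  ∙-cong : ∀ {f f' g g'} → f ≈ f' → g ≈ g' → (f ∙ g) ≈ (f' ∙ g')
  ∙-cong {f} {f'} {g} {g'} (mk≈ ks ms e) (mk≈ ls ns e') = mk≈ (ks ++ ls) (++⁺ ms ns) λ v → begin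
      f v + g v                                     ≡⟨ cong₂ _+_ (e v) (e' v) ⟩
      (f' v + combo {V} ks v) + (g' v + combo {V} ls v)     ≡⟨ swap4 (f' v) _ _ _ ⟩
      (f' v + g' v) + (combo {V} ks v + combo {V} ls v)     ≡⟨ cong ((f' v + g' v) +_) (sym (combo-++ ks ls v)) ⟩
      (f' v + g' v) + combo (ks ++ ls) v            ∎
    where
    open ≡-Reasoning
    swap4 : ∀ a b c d → (a + b) + (c + d) ≡ (a + c) + (b + d)
    swap4 a b c d = begin
      (a + b) + (c + d) ≡⟨ +-assoc a b (c + d) ⟩
      a + (b + (c + d)) ≡⟨ cong (a +_) (sym (+-assoc b c d)) ⟩
      a + ((b + c) + d) ≡⟨ cong (λ x → a + (x + d)) (+-comm b c) ⟩
      a + ((c + b) + d) ≡⟨ cong (a +_) (+-assoc c b d) ⟩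
      a + (c + (b + d)) ≡⟨ sym (+-assoc a c (b + d)) ⟩
      (a + c) + (b + d) ∎

  ⁻¹-cong : ∀ {f g} → f ≈ g → (f ⁻¹) ≈ (g ⁻¹)
  ⁻¹-cong {f} {g} (mk≈ ks ms e) = mk≈ (neg ks) (neg-all ks ms) λ v → begin
      - f v                     ≡⟨ cong -_ (e v) ⟩
      - (g v + combo {V} ks v)      ≡⟨ neg-distrib-+ (g v) (combo {V} ks v) ⟩
      - g v + - combo {V} ks v      ≡⟨ cong (- g v +_) (sym (combo-neg ks v)) ⟩
      - g v + combo (neg ks) v  ∎
    where open ≡-Reasoning

  isAbelianGroup : IsAbelianGroup _≈_ _∙_ ε _⁻¹
  isAbelianGroup = record
    { isGroup = record
      { isMonoid = record
        { isSemigroup = record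
          { isMagma = record
            { isEquivalence = record { refl = ≈-refl ; sym = ≈-sym ; trans = ≈-trans }
            ; ∙-cong = ∙-cong }
          ; assoc = λ f g h → pw (λ v → +-assoc (f v) (g v) (h v)) }
        ; identity = (λ f → pw (λ v → +-identityˡ (f v))) , (λ f → pw (λ v → +-identityʳ (f v))) }
      ; inverse = (λ f → pw (λ v → +-inverseˡ (f v))) , (λ f → pw (λ v → +-inverseʳ (f v)))
      ; ⁻¹-cong = ⁻¹-cong }
    ; comm = λ f g → pw (λ v → +-comm (f v) (g v)) }

  group : AbelianGroup 0ℓ 0ℓ
  group = record { isAbelianGroup = isAbelianGroup }

⟨_∣_⟩ : (V : Set) → List (V → ℤ) → AbelianGroup 0ℓ 0ℓ
⟨ V ∣ rels ⟩ = Presented.group {V} rels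

Vars : ℕ → ℕ → ℕ → Set
Vars nR nC nS = Fin nR ⊎ Fin nC ⊎ Fin nS

module _ {nR nC nS : ℕ} where

  _≟V_ : (x y : Vars nR nC nS) → Relation.Nullary.Dec (x ≡ y)
  _≟V_ = ≡-dec _≟F_ (≡-dec _≟F_ _≟F_)

  gen : Vars nR nC nS → Vars nR nC nS → ℤ
  gen x y with x ≟V y
  ... | yes _ = 1ℤ
  ... | no  _ = 0ℤ

  relator : Triple nR nC nS → Vars nR nC nS → ℤ
  relator (r , c , s) v = gen (inj₁ r) v + gen (inj₂ (inj₁ c)) v + gen (inj₂ (inj₂ s)) v

  𝒜 : List (Triple nR nC nS) → AbelianGroup 0ℓ 0ℓ
  𝒜 W = ⟨ Vars nR nC nS ∣ map relator W ⟩

  𝒜* : List (Triple nR nC nS) → Triple nR nC nS → AbelianGroup 0ℓ 0ℓ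
  𝒜* W (r₀ , c₀ , s₀) = ⟨ Vars nR nC nS ∣
     map relator W ++ (gen (inj₁ r₀) ∷ gen (inj₂ (inj₁ c₀)) ∷ gen (inj₂ (inj₂ s₀)) ∷ []) ⟩

ℤ-group : AbelianGroup 0ℓ 0ℓ
ℤ-group = +-0-abelianGroup

_⊕_ : AbelianGroup 0ℓ 0ℓ → AbelianGroup 0ℓ 0ℓ → AbelianGroup 0ℓ 0ℓ
G ⊕ H = DP.abelianGroup G H
infixr 5 _⊕_

open import Algebra.Morphism.Structures using (module GroupMorphisms)
_≅_ : AbelianGroup 0ℓ 0ℓ → AbelianGroup 0ℓ 0ℓ → Set
G ≅ H = Σ (AbelianGroup.Carrier G → AbelianGroup.Carrier H) λ f →
  GroupMorphisms.IsGroupIsomorphism (AbelianGroup.rawGroup G) (AbelianGroup.rawGroup H) f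

module Submission where

open import Defs
open import Level using (0ℓ)
open import Data.Nat using (ℕ; suc)
open import Data.List using (List; []; _∷_; _++_; map)
open import Data.List.Membership.Propositional using (_∈_)
open import Data.Fin using (Fin; punchIn)
open import Data.Fin.Properties using (punchInᵢ≢i)
open import Data.Integer using (ℤ; _+_; _*_; -_; _-_; 0ℤ; 1ℤ; -1ℤ)
open import Data.Integer.Properties
  using (+-*-semiring; +-identityˡ; +-identityʳ; +-assoc; *-distribˡ-+; *-identityʳ;
         *-zeroˡ; *-zeroʳ; -1*i≡-i; i-j≡0⇒i≡j)
open import Data.Integer.Tactic.RingSolver using (solve-∀)
open import Algebra.Properties.Semiring.Sum +-*-semiring
  using (sum; sum-cong-≗; sum-replicate-zero; sum-remove; ∑-distrib-+; *-distribˡ-sum)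
open import Data.Product using (∃; ∃-syntax; _×_; _,_; proj₂)
open import Data.Sum using (inj₁; inj₂)
open import Data.Sum.Properties using (inj₁-injective; inj₂-injective)
open import Data.List.Relation.Unary.All using (All; []; _∷_)
import Data.List.Relation.Unary.All as All
open import Data.List.Relation.Unary.Any using (here; there)
open import Data.List.Membership.Propositional.Properties
  using (∈-map⁺; ∈-map⁻; ∈-++⁺ˡ; ∈-++⁺ʳ; ∈-++⁻)
open import Function using (_∘_)
open import Relation.Binary.PropositionalEquality
open import Relation.Nullary using (yes; no)
open import Data.Empty using (⊥-elim)
open import Algebra.Bundles using (AbelianGroup)
open import Algebra.Properties.Group (AbelianGroup.group ℤ-group) using (identityʳ-unique)

-- The isomorphism is  g ↦ (g , ρ(g) , κ(g)),  where ρ and κ are the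
-- homomorphisms 𝒜 → ℤ obtained by weighing the indeterminates with
--     ρ  (rowWeight) :  row ↦ 1,  column ↦ 0,  symbol ↦ -1,
--     κ  (colWeight) :  row ↦ 0,  column ↦ 1,  symbol ↦ -1.
-- Both weights give r + c + s the value 0 for every triple, so they
-- descend to 𝒜.  The map is onto since r₀ and c₀ vanish in 𝒜* while
-- ρ(r₀) = 1, ρ(c₀) = 0, κ(r₀) = 0, κ(c₀) = 1.  It is one-to-one: if
-- g - h = (relators of W) + k₁ r₀ + k₂ c₀ + k₃ s₀ and ρ, κ agree on g
-- and h, then k₁ - k₃ = k₂ - k₃ = 0, so the extra part is k₃ (r₀+c₀+s₀),
-- a relator of W.

sum-zero : ∀ {n} (f : Fin n → ℤ) → (∀ j → f j ≡ 0ℤ) → sum f ≡ 0ℤ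
sum-zero {n} f f≡0 = trans (sum-cong-≗ f≡0) (sum-replicate-zero n)

sum-single : ∀ {n} (f : Fin (suc n) → ℤ) i → (∀ j → j ≢ i → f j ≡ 0ℤ) → sum f ≡ f i
sum-single f i others≡0 = begin
  sum f                           ≡⟨ sum-remove {i = i} f ⟩
  f i + sum (f ∘ punchIn i)       ≡⟨ cong (f i +_) rest≡0 ⟩
  f i + 0ℤ                        ≡⟨ +-identityʳ (f i) ⟩
  f i                             ∎
  where
  open ≡-Reasoning
  rest≡0 : sum (f ∘ punchIn i) ≡ 0ℤ
  rest≡0 = sum-zero (f ∘ punchIn i) (λ j → others≡0 (punchIn i j) (punchInᵢ≢i i j))

module _ {nR nC nS : ℕ} where

  private
    V : Set
    V = Vars nR nC nS

  rowV : Fin nR → V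
  rowV = inj₁
  colV : Fin nC → V
  colV = inj₂ ∘ inj₁
  symV : Fin nS → V
  symV = inj₂ ∘ inj₂

  gen-self : ∀ x → gen {nR} {nC} {nS} x x ≡ 1ℤ
  gen-self x with x ≟V x
  ... | yes _ = refl
  ... | no x≢x = ⊥-elim (x≢x refl)

  gen-other : ∀ x v → v ≢ x → gen {nR} {nC} {nS} x v ≡ 0ℤ
  gen-other x v v≢x with x ≟V v
  ... | yes x≡v = ⊥-elim (v≢x (sym x≡v))
  ... | no _ = refl

  Σ𝒱 : (V → ℤ) → ℤ
  Σ𝒱 f = sum (f ∘ rowV) + sum (f ∘ colV) + sum (f ∘ symV)

  Σ𝒱-cong : ∀ {f g} → (∀ v → f v ≡ g v) → Σ𝒱 f ≡ Σ𝒱 g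
  Σ𝒱-cong f≗g =
    cong₂ _+_ (cong₂ _+_ (sum-cong-≗ (f≗g ∘ rowV)) (sum-cong-≗ (f≗g ∘ colV)))
              (sum-cong-≗ (f≗g ∘ symV))

  Σ𝒱-+ : ∀ f g → Σ𝒱 (λ v → f v + g v) ≡ Σ𝒱 f + Σ𝒱 g
  Σ𝒱-+ f g = begin
    Σ𝒱 (λ v → f v + g v)
      ≡⟨ cong₂ _+_ (cong₂ _+_ (∑-distrib-+ (f ∘ rowV) (g ∘ rowV))
                              (∑-distrib-+ (f ∘ colV) (g ∘ colV)))
                   (∑-distrib-+ (f ∘ symV) (g ∘ symV)) ⟩
    (sum (f ∘ rowV) + sum (g ∘ rowV)) + (sum (f ∘ colV) + sum (g ∘ colV))
      + (sum (f ∘ symV) + sum (g ∘ symV))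
      ≡⟨ regroup (sum (f ∘ rowV)) (sum (g ∘ rowV)) (sum (f ∘ colV)) (sum (g ∘ colV))
                 (sum (f ∘ symV)) (sum (g ∘ symV)) ⟩
    Σ𝒱 f + Σ𝒱 g ∎
    where
    open ≡-Reasoning
    regroup : ∀ a b c d e f → (a + b) + (c + d) + (e + f) ≡ (a + c + e) + (b + d + f)
    regroup = solve-∀

  Σ𝒱-* : ∀ k f → Σ𝒱 (λ v → k * f v) ≡ k * Σ𝒱 f
  Σ𝒱-* k f = begin
    Σ𝒱 (λ v → k * f v)
      ≡⟨ sym (cong₂ _+_ (cong₂ _+_ (*-distribˡ-sum k (f ∘ rowV)) (*-distribˡ-sum k (f ∘ colV)))
                        (*-distribˡ-sum k (f ∘ symV))) ⟩
    k * sum (f ∘ rowV) + k * sum (f ∘ colV) + k * sum (f ∘ symV)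
      ≡⟨ distrib k (sum (f ∘ rowV)) (sum (f ∘ colV)) (sum (f ∘ symV)) ⟩
    k * Σ𝒱 f ∎
    where
    open ≡-Reasoning
    distrib : ∀ k a b c → k * a + k * b + k * c ≡ k * (a + b + c)
    distrib = solve-∀

  sum-part-on : ∀ {n} f (ι : Fin n → V) → (∀ {i j} → ι i ≡ ι j → i ≡ j) →
                ∀ i → (∀ v → v ≢ ι i → f v ≡ 0ℤ) → sum (f ∘ ι) ≡ f (ι i)
  sum-part-on {suc _} f ι ι-inj i others≡0 =
    sum-single (f ∘ ι) i (λ j j≢i → others≡0 (ι j) (j≢i ∘ ι-inj))

  sum-part-off : ∀ {n} f x (ι : Fin n → V) → (∀ j → ι j ≢ x) →
                 (∀ v → v ≢ x → f v ≡ 0ℤ) → sum (f ∘ ι) ≡ 0ℤ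
  sum-part-off f x ι misses others≡0 = sum-zero (f ∘ ι) (λ j → others≡0 (ι j) (misses j))

  Σ𝒱-single : ∀ f x → (∀ v → v ≢ x → f v ≡ 0ℤ) → Σ𝒱 f ≡ f x
  Σ𝒱-single f x@(inj₁ r) others≡0 = begin
    Σ𝒱 f          ≡⟨ cong₂ _+_ (cong₂ _+_ (sum-part-on f rowV inj₁-injective r others≡0)
                                           (sum-part-off f x colV (λ _ ()) others≡0))
                                (sum-part-off f x symV (λ _ ()) others≡0) ⟩
    f x + 0ℤ + 0ℤ ≡⟨ trans (+-identityʳ _) (+-identityʳ _) ⟩
    f x           ∎
    where open ≡-Reasoning
  Σ𝒱-single f x@(inj₂ (inj₁ c)) others≡0 = begin
    Σ𝒱 f          ≡⟨ cong₂ _+_ (cong₂ _+_ (sum-part-off f x rowV (λ _ ()) others≡0)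
                                           (sum-part-on f colV (inj₁-injective ∘ inj₂-injective) c others≡0))
                                (sum-part-off f x symV (λ _ ()) others≡0) ⟩
    0ℤ + f x + 0ℤ ≡⟨ trans (+-identityʳ _) (+-identityˡ _) ⟩
    f x           ∎
    where open ≡-Reasoning
  Σ𝒱-single f x@(inj₂ (inj₂ s)) others≡0 = begin
    Σ𝒱 f          ≡⟨ cong₂ _+_ (cong₂ _+_ (sum-part-off f x rowV (λ _ ()) others≡0)
                                           (sum-part-off f x colV (λ _ ()) others≡0))
                                (sum-part-on f symV (inj₂-injective ∘ inj₂-injective) s others≡0) ⟩
    0ℤ + 0ℤ + f x ≡⟨ +-identityˡ _ ⟩
    f x           ∎
    where open ≡-Reasoning

  Weight : Set
  Weight = V → ℤ

  weigh : Weight → (V → ℤ) → ℤ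
  weigh w g = Σ𝒱 (λ v → w v * g v)

  weigh-cong : ∀ w {f g} → (∀ v → f v ≡ g v) → weigh w f ≡ weigh w g
  weigh-cong w f≗g = Σ𝒱-cong (λ v → cong (w v *_) (f≗g v))

  weigh-+ : ∀ w f g → weigh w (λ v → f v + g v) ≡ weigh w f + weigh w g
  weigh-+ w f g =
    trans (Σ𝒱-cong (λ v → *-distribˡ-+ (w v) (f v) (g v))) (Σ𝒱-+ (λ v → w v * f v) (λ v → w v * g v))

  weigh-* : ∀ w k f → weigh w (λ v → k * f v) ≡ k * weigh w f
  weigh-* w k f = trans (Σ𝒱-cong (λ v → exchange (w v) k (f v))) (Σ𝒱-* k (λ v → w v * f v))
    where
    exchange : ∀ a k b → a * (k * b) ≡ k * (a * b)
    exchange = solve-∀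

  weigh-0 : ∀ w → weigh w (λ _ → 0ℤ) ≡ 0ℤ
  weigh-0 w = trans (weigh-* w 0ℤ (λ _ → 0ℤ)) (*-zeroˡ (weigh w (λ _ → 0ℤ)))

  weigh-neg : ∀ w f → weigh w (λ v → - f v) ≡ - weigh w f
  weigh-neg w f = begin
    weigh w (λ v → - f v)     ≡⟨ weigh-cong w (λ v → sym (-1*i≡-i (f v))) ⟩
    weigh w (λ v → -1ℤ * f v) ≡⟨ weigh-* w -1ℤ f ⟩
    -1ℤ * weigh w f           ≡⟨ -1*i≡-i (weigh w f) ⟩
    - weigh w f               ∎
    where open ≡-Reasoning

  weigh-gen : ∀ w x → weigh w (gen x) ≡ w x
  weigh-gen w x = begin
    weigh w (gen x) ≡⟨ Σ𝒱-single (λ v → w v * gen x v) x off-x ⟩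
    w x * gen x x   ≡⟨ cong (w x *_) (gen-self x) ⟩
    w x * 1ℤ        ≡⟨ *-identityʳ (w x) ⟩
    w x             ∎
    where
    open ≡-Reasoning
    off-x : ∀ v → v ≢ x → w v * gen x v ≡ 0ℤ
    off-x v v≢x = trans (cong (w v *_) (gen-other x v v≢x)) (*-zeroʳ (w v))

  weigh-combo-∷ : ∀ w k ρ ks →
                  weigh w (combo ((k , ρ) ∷ ks)) ≡ k * weigh w ρ + weigh w (combo ks)
  weigh-combo-∷ w k ρ ks =
    trans (weigh-+ w (λ v → k * ρ v) (combo ks)) (cong (_+ weigh w (combo ks)) (weigh-* w k ρ))

  weigh-relator : ∀ w r c s → weigh w (relator (r , c , s)) ≡ w (rowV r) + w (colV c) + w (symV s)
  weigh-relator w r c s = begin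
    weigh w (relator (r , c , s))
      ≡⟨ weigh-+ w (λ v → gen (rowV r) v + gen (colV c) v) (gen (symV s)) ⟩
    weigh w (λ v → gen (rowV r) v + gen (colV c) v) + weigh w (gen (symV s))
      ≡⟨ cong (_+ weigh w (gen (symV s))) (weigh-+ w (gen (rowV r)) (gen (colV c))) ⟩
    weigh w (gen (rowV r)) + weigh w (gen (colV c)) + weigh w (gen (symV s))
      ≡⟨ cong₂ _+_ (cong₂ _+_ (weigh-gen w (rowV r)) (weigh-gen w (colV c))) (weigh-gen w (symV s)) ⟩
    w (rowV r) + w (colV c) + w (symV s) ∎
    where open ≡-Reasoning

  Balanced : Weight → Set
  Balanced w = ∀ r c s → w (rowV r) + w (colV c) + w (symV s) ≡ 0ℤ

  weigh-relations : ∀ {W : List (Triple nR nC nS)} w → Balanced w →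
                    ∀ ks → All (λ p → proj₂ p ∈ map relator W) ks → weigh w (combo ks) ≡ 0ℤ
  weigh-relations w balanced [] [] = weigh-0 w
  weigh-relations w balanced ((k , ρ) ∷ ks) (ρ∈ ∷ ks∈) with ∈-map⁻ relator ρ∈
  ... | (r , c , s) , _ , refl = begin
    weigh w (combo ((k , relator (r , c , s)) ∷ ks))
      ≡⟨ weigh-combo-∷ w k (relator (r , c , s)) ks ⟩
    k * weigh w (relator (r , c , s)) + weigh w (combo ks)
      ≡⟨ cong₂ (λ a b → k * a + b) (trans (weigh-relator w r c s) (balanced r c s))
                                   (weigh-relations w balanced ks ks∈) ⟩
    k * 0ℤ + 0ℤ
      ≡⟨ cong (_+ 0ℤ) (*-zeroʳ k) ⟩
    0ℤ ∎
    where open ≡-Reasoning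

  weigh-resp-𝒜 : ∀ {W : List (Triple nR nC nS)} w → Balanced w →
                 ∀ {f g} → AbelianGroup._≈_ (𝒜 W) f g → weigh w f ≡ weigh w g
  weigh-resp-𝒜 {W} w balanced {f} {g} (Presented.mk≈ ks ks∈ f≡g+ks) = begin
    weigh w f                          ≡⟨ weigh-cong w f≡g+ks ⟩
    weigh w (λ v → g v + combo ks v)   ≡⟨ weigh-+ w g (combo ks) ⟩
    weigh w g + weigh w (combo ks)     ≡⟨ cong (weigh w g +_) (weigh-relations {W} w balanced ks ks∈) ⟩
    weigh w g + 0ℤ                     ≡⟨ +-identityʳ (weigh w g) ⟩
    weigh w g                          ∎
    where open ≡-Reasoning

split-combo : ∀ {A : Set} (rels extras : List (A → ℤ)) ks →
              All (λ p → proj₂ p ∈ rels ++ extras) ks →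
              ∃[ ks₁ ] ∃[ ks₂ ] All (λ p → proj₂ p ∈ rels) ks₁ × All (λ p → proj₂ p ∈ extras) ks₂
                              × (∀ a → combo ks a ≡ combo ks₁ a + combo ks₂ a)
split-combo rels extras [] [] = [] , [] , [] , [] , λ _ → refl
split-combo rels extras ((k , ρ) ∷ ks) (ρ∈ ∷ ks∈)
  with split-combo rels extras ks ks∈ | ∈-++⁻ rels ρ∈
... | ks₁ , ks₂ , ks₁∈ , ks₂∈ , ks≡ | inj₁ ρ∈rels =
  (k , ρ) ∷ ks₁ , ks₂ , ρ∈rels ∷ ks₁∈ , ks₂∈ ,
  λ a → trans (cong (k * ρ a +_) (ks≡ a)) (sym (+-assoc (k * ρ a) (combo ks₁ a) (combo ks₂ a)))
... | ks₁ , ks₂ , ks₁∈ , ks₂∈ , ks≡ | inj₂ ρ∈extras =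
  ks₁ , (k , ρ) ∷ ks₂ , ks₁∈ , ρ∈extras ∷ ks₂∈ ,
  λ a → trans (cong (k * ρ a +_) (ks≡ a)) (move-past (k * ρ a) (combo ks₁ a) (combo ks₂ a))
  where
  move-past : ∀ x y z → x + (y + z) ≡ y + (x + z)
  move-past = solve-∀

collect₃ : ∀ {A : Set} (x y z : A → ℤ) ks → All (λ p → proj₂ p ∈ x ∷ y ∷ z ∷ []) ks →
           ∃[ k₁ ] ∃[ k₂ ] ∃[ k₃ ] (∀ a → combo ks a ≡ k₁ * x a + k₂ * y a + k₃ * z a)
collect₃ x y z [] [] = 0ℤ , 0ℤ , 0ℤ , λ _ → refl
collect₃ x y z ((k , ρ) ∷ ks) (ρ∈ ∷ ks∈) with collect₃ x y z ks ks∈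
... | k₁ , k₂ , k₃ , ks≡ with ρ∈
...   | here refl =
  k + k₁ , k₂ , k₃ , λ a → trans (cong (k * x a +_) (ks≡ a)) (add-to-x k k₁ k₂ k₃ (x a) (y a) (z a))
  where
  add-to-x : ∀ k k₁ k₂ k₃ x y z →
             k * x + (k₁ * x + k₂ * y + k₃ * z) ≡ (k + k₁) * x + k₂ * y + k₃ * z
  add-to-x = solve-∀
...   | there (here refl) =
  k₁ , k + k₂ , k₃ , λ a → trans (cong (k * y a +_) (ks≡ a)) (add-to-y k k₁ k₂ k₃ (x a) (y a) (z a))
  where
  add-to-y : ∀ k k₁ k₂ k₃ x y z →
             k * y + (k₁ * x + k₂ * y + k₃ * z) ≡ k₁ * x + (k + k₂) * y + k₃ * z
  add-to-y = solve-∀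
...   | there (there (here refl)) =
  k₁ , k₂ , k + k₃ , λ a → trans (cong (k * z a +_) (ks≡ a)) (add-to-z k k₁ k₂ k₃ (x a) (y a) (z a))
  where
  add-to-z : ∀ k k₁ k₂ k₃ x y z →
             k * z + (k₁ * x + k₂ * y + k₃ * z) ≡ k₁ * x + k₂ * y + (k + k₃) * z
  add-to-z = solve-∀

module _ {nR nC nS : ℕ} where

  private
    V : Set
    V = Vars nR nC nS

  weigh-gens₃ : ∀ w (x y z : V) k₁ k₂ k₃ →
                weigh w (λ v → k₁ * gen x v + k₂ * gen y v + k₃ * gen z v) ≡ k₁ * w x + k₂ * w y + k₃ * w z
  weigh-gens₃ w x y z k₁ k₂ k₃ = begin
    weigh w (λ v → k₁ * gen x v + k₂ * gen y v + k₃ * gen z v)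
      ≡⟨ weigh-+ w (λ v → k₁ * gen x v + k₂ * gen y v) (λ v → k₃ * gen z v) ⟩
    weigh w (λ v → k₁ * gen x v + k₂ * gen y v) + weigh w (λ v → k₃ * gen z v)
      ≡⟨ cong (_+ weigh w (λ v → k₃ * gen z v)) (weigh-+ w (λ v → k₁ * gen x v) (λ v → k₂ * gen y v)) ⟩
    weigh w (λ v → k₁ * gen x v) + weigh w (λ v → k₂ * gen y v) + weigh w (λ v → k₃ * gen z v)
      ≡⟨ cong₂ _+_ (cong₂ _+_ (scaled k₁ x) (scaled k₂ y)) (scaled k₃ z) ⟩
    k₁ * w x + k₂ * w y + k₃ * w z ∎
    where
    open ≡-Reasoning
    scaled : ∀ k x → weigh w (λ v → k * gen x v) ≡ k * w x
    scaled k x = trans (weigh-* w k (gen x)) (cong (k *_) (weigh-gen w x))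

  weigh-shift : ∀ {W : List (Triple nR nC nS)} w → Balanced w →
                ∀ {g h} ks → All (λ p → proj₂ p ∈ map relator W) ks → (d : V → ℤ) →
                (∀ v → g v ≡ h v + (combo ks v + d v)) → weigh w g ≡ weigh w h + weigh w d
  weigh-shift {W} w balanced {g} {h} ks ks∈ d g≡h+ks+d = begin
    weigh w g                                      ≡⟨ weigh-cong w g≡h+ks+d ⟩
    weigh w (λ v → h v + (combo ks v + d v))       ≡⟨ weigh-+ w h (λ v → combo ks v + d v) ⟩
    weigh w h + weigh w (λ v → combo ks v + d v)   ≡⟨ cong (weigh w h +_) (weigh-+ w (combo ks) d) ⟩
    weigh w h + (weigh w (combo ks) + weigh w d)   ≡⟨ cong (λ e → weigh w h + (e + weigh w d))
                                                           (weigh-relations {W = W} w balanced ks ks∈) ⟩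
    weigh w h + (0ℤ + weigh w d)                   ≡⟨ cong (weigh w h +_) (+-identityˡ (weigh w d)) ⟩
    weigh w h + weigh w d                          ∎
    where open ≡-Reasoning

  rowWeight : V → ℤ
  rowWeight (inj₁ _)        = 1ℤ
  rowWeight (inj₂ (inj₁ _)) = 0ℤ
  rowWeight (inj₂ (inj₂ _)) = -1ℤ

  colWeight : V → ℤ
  colWeight (inj₁ _)        = 0ℤ
  colWeight (inj₂ (inj₁ _)) = 1ℤ
  colWeight (inj₂ (inj₂ _)) = -1ℤ

  rowWeight-balanced : Balanced rowWeight
  rowWeight-balanced _ _ _ = refl

  colWeight-balanced : Balanced colWeight
  colWeight-balanced _ _ _ = refl

module Splitting {nR nC nS : ℕ} (W : List (Triple nR nC nS))
                 {r₀ : Fin nR} {c₀ : Fin nC} {s₀ : Fin nS} (t₀∈W : (r₀ , c₀ , s₀) ∈ W) where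

  private
    V : Set
    V = Vars nR nC nS
    t₀ : Triple nR nC nS
    t₀ = (r₀ , c₀ , s₀)
    g₀ʳ g₀ᶜ g₀ˢ : V → ℤ
    g₀ʳ = gen (rowV r₀)
    g₀ᶜ = gen (colV c₀)
    g₀ˢ = gen (symV s₀)
    relsW extras : List (V → ℤ)
    relsW  = map relator W
    extras = g₀ʳ ∷ g₀ᶜ ∷ g₀ˢ ∷ []
    module 𝒜W  = Presented relsW
    module 𝒜*W = Presented (relsW ++ extras)
    Target : AbelianGroup 0ℓ 0ℓ
    Target = 𝒜* W t₀ ⊕ ℤ-group ⊕ ℤ-group
    open AbelianGroup (𝒜 W) using () renaming (_≈_ to _≈𝒜_)
    open AbelianGroup Target using () renaming (_≈_ to _≈T_; trans to ≈T-trans)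

  Φ : (V → ℤ) → (V → ℤ) × ℤ × ℤ
  Φ g = g , weigh rowWeight g , weigh colWeight g

  Φ-cong : ∀ {g h} → g ≈𝒜 h → Φ g ≈T Φ h
  Φ-cong g≈h@(𝒜W.mk≈ ks ks∈ g≡h+ks) =
    𝒜*W.mk≈ ks (All.map ∈-++⁺ˡ ks∈) g≡h+ks ,
    weigh-resp-𝒜 {W = W} rowWeight rowWeight-balanced g≈h ,
    weigh-resp-𝒜 {W = W} colWeight colWeight-balanced g≈h

  Φ-injective : ∀ {g h} → Φ g ≈T Φ h → g ≈𝒜 h
  Φ-injective {g} {h} (𝒜*W.mk≈ ks ks∈ g≡h+ks , rows≡ , cols≡)
    with split-combo relsW extras ks ks∈
  ... | ks₁ , ks₂ , ks₁∈ , ks₂∈ , ks≡ with collect₃ g₀ʳ g₀ᶜ g₀ˢ ks₂ ks₂∈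
  ... | k₁ , k₂ , k₃ , ks₂≡ = 𝒜W.mk≈ ((k₃ , relator t₀) ∷ ks₁) (∈-map⁺ relator t₀∈W ∷ ks₁∈) g≡h+relations
    where
    d : V → ℤ
    d v = k₁ * g₀ʳ v + k₂ * g₀ᶜ v + k₃ * g₀ˢ v
    g≡h+ks₁+d : ∀ v → g v ≡ h v + (combo ks₁ v + d v)
    g≡h+ks₁+d v = trans (g≡h+ks v) (cong (h v +_) (trans (ks≡ v) (cong (combo ks₁ v +_) (ks₂≡ v))))
    vanishes : ∀ w → Balanced w → weigh w g ≡ weigh w h →
               k₁ * w (rowV r₀) + k₂ * w (colV c₀) + k₃ * w (symV s₀) ≡ 0ℤ
    vanishes w balanced same = identityʳ-unique (weigh w h) _ (begin
      weigh w h + (k₁ * w (rowV r₀) + k₂ * w (colV c₀) + k₃ * w (symV s₀))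
        ≡⟨ cong (weigh w h +_) (weigh-gens₃ w (rowV r₀) (colV c₀) (symV s₀) k₁ k₂ k₃) ⟨
      weigh w h + weigh w d
        ≡⟨ weigh-shift {W = W} w balanced {g} {h} ks₁ ks₁∈ d g≡h+ks₁+d ⟨
      weigh w g
        ≡⟨ same ⟩
      weigh w h ∎)
      where open ≡-Reasoning
    k₁≡k₃ : k₁ ≡ k₃
    k₁≡k₃ = i-j≡0⇒i≡j k₁ k₃ (trans (by-rows k₁ k₂ k₃) (vanishes rowWeight rowWeight-balanced rows≡))
      where
      by-rows : ∀ k₁ k₂ k₃ → k₁ - k₃ ≡ k₁ * 1ℤ + k₂ * 0ℤ + k₃ * (- 1ℤ)
      by-rows = solve-∀
    k₂≡k₃ : k₂ ≡ k₃
    k₂≡k₃ = i-j≡0⇒i≡j k₂ k₃ (trans (by-cols k₁ k₂ k₃) (vanishes colWeight colWeight-balanced cols≡))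
      where
      by-cols : ∀ k₁ k₂ k₃ → k₂ - k₃ ≡ k₁ * 0ℤ + k₂ * 1ℤ + k₃ * (- 1ℤ)
      by-cols = solve-∀
    -- so d = k₃ (r₀ + c₀ + s₀) is a multiple of the relator of t₀
    g≡h+relations : ∀ v → g v ≡ h v + (k₃ * relator t₀ v + combo ks₁ v)
    g≡h+relations v = begin
      g v                                                          ≡⟨ g≡h+ks₁+d v ⟩
      h v + (combo ks₁ v + (k₁ * g₀ʳ v + k₂ * g₀ᶜ v + k₃ * g₀ˢ v))
        ≡⟨ cong₂ (λ a b → h v + (combo ks₁ v + (a * g₀ʳ v + b * g₀ᶜ v + k₃ * g₀ˢ v))) k₁≡k₃ k₂≡k₃ ⟩
      h v + (combo ks₁ v + (k₃ * g₀ʳ v + k₃ * g₀ᶜ v + k₃ * g₀ˢ v))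
        ≡⟨ factor (h v) (combo ks₁ v) k₃ (g₀ʳ v) (g₀ᶜ v) (g₀ˢ v) ⟩
      h v + (k₃ * relator t₀ v + combo ks₁ v)                      ∎
      where
      open ≡-Reasoning
      factor : ∀ h c k x y z → h + (c + (k * x + k * y + k * z)) ≡ h + (k * (x + y + z) + c)
      factor = solve-∀

  -- (g , a , b) is the image of  g + (a - ρ g) r₀ + (b - κ g) c₀,
  -- as r₀ and c₀ vanish in 𝒜*.
  Φ-surjective : ∀ y → ∃ λ x → ∀ {z} → z ≈𝒜 x → Φ z ≈T y
  Φ-surjective (g , a , b) = x , λ z≈x → ≈T-trans (Φ-cong z≈x) Φx≈
    where
    c₁ c₂ : ℤ
    c₁ = a - weigh rowWeight g
    c₂ = b - weigh colWeight g
    lift : List (ℤ × (V → ℤ))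
    lift = (c₁ , g₀ʳ) ∷ (c₂ , g₀ᶜ) ∷ []
    x : V → ℤ
    x v = g v + combo lift v
    weigh-x : ∀ w → weigh w x ≡ weigh w g + (c₁ * w (rowV r₀) + (c₂ * w (colV c₀) + 0ℤ))
    weigh-x w = begin
      weigh w x                                                         ≡⟨ weigh-+ w g (combo lift) ⟩
      weigh w g + weigh w (combo lift)
        ≡⟨ cong (weigh w g +_) (weigh-combo-∷ w c₁ g₀ʳ ((c₂ , g₀ᶜ) ∷ [])) ⟩
      weigh w g + (c₁ * weigh w g₀ʳ + weigh w (combo ((c₂ , g₀ᶜ) ∷ [])))
        ≡⟨ cong (λ e → weigh w g + (c₁ * weigh w g₀ʳ + e)) (weigh-combo-∷ w c₂ g₀ᶜ []) ⟩
      weigh w g + (c₁ * weigh w g₀ʳ + (c₂ * weigh w g₀ᶜ + weigh w (λ _ → 0ℤ)))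
        ≡⟨ cong₂ (λ e₁ e₂ → weigh w g + (c₁ * e₁ + e₂)) (weigh-gen w (rowV r₀))
                 (cong₂ (λ e₂ e₃ → c₂ * e₂ + e₃) (weigh-gen w (colV c₀)) (weigh-0 w)) ⟩
      weigh w g + (c₁ * w (rowV r₀) + (c₂ * w (colV c₀) + 0ℤ))          ∎
      where open ≡-Reasoning
    fix-row : ∀ G a c₂ → G + ((a - G) * 1ℤ + (c₂ * 0ℤ + 0ℤ)) ≡ a
    fix-row = solve-∀
    fix-col : ∀ G b c₁ → G + (c₁ * 0ℤ + ((b - G) * 1ℤ + 0ℤ)) ≡ b
    fix-col = solve-∀
    Φx≈ : Φ x ≈T (g , a , b)
    Φx≈ = 𝒜*W.mk≈ lift (∈-++⁺ʳ relsW (here refl) ∷ ∈-++⁺ʳ relsW (there (here refl)) ∷ []) (λ _ → refl)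
        , trans (weigh-x rowWeight) (fix-row (weigh rowWeight g) a c₂)
        , trans (weigh-x colWeight) (fix-col (weigh colWeight g) b c₁)

  iso : 𝒜 W ≅ Target
  iso = Φ , record
    { isGroupMonomorphism = record
      { isGroupHomomorphism = record
        { isMonoidHomomorphism = record
          { isMagmaHomomorphism = record
            { isRelHomomorphism = record { cong = Φ-cong }
            ; homo = λ f g → 𝒜*W.≈-refl , weigh-+ rowWeight f g , weigh-+ colWeight f g }
          ; ε-homo = 𝒜*W.≈-refl {λ _ → 0ℤ}
                   , weigh-0 {nR} {nC} {nS} rowWeight , weigh-0 {nR} {nC} {nS} colWeight }
        ; ⁻¹-homo = λ f → 𝒜*W.≈-refl , weigh-neg rowWeight f , weigh-neg colWeight f }
      ; injective = Φ-injective }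
    ; surjective = Φ-surjective }

lemma4p1 : (nR nC nS : ℕ) (W B : List (Triple nR nC nS)) →
    IsSphericalBitrade W B →
    (t₀ : Triple nR nC nS) → t₀ ∈ W →
    𝒜 W ≅ (𝒜* W t₀ ⊕ ℤ-group ⊕ ℤ-group)
lemma4p1 nR nC nS W B _ (r₀ , c₀ , s₀) t₀∈W = Splitting.iso W t₀∈W
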